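{- Let $n\ge 1$ and let $\alpha$ be a tight stable $n$-subset of $[2n+2]$. Then $\alpha$ has exactly one outer neighbor in $SG_{n,2}$.
   Context: All arithmetic on elements of $[2n+2]$ is modulo $2n+2$ (with representatives in $[2n+2]$). An $n$-subset of $[2n+2]$ is stable if it contains no two cyclically consecutive elements ($\{i,i+1\}$ or $\{1,2n+2\}$). $SG_{n,2}$ is the graph on stable $n$-subsets of $[2n+2]$ with adjacency given by disjointness. A stable $n$-set $\alpha$ is tight if $\alpha=\{i,i+2,i+4,\dots,i+2(n-1)\}$ for some $i\in[2n+2]$. Two stable $n$-sets $\alpha,\beta$ are outer neighbors if they are adjacent in $SG_{n,2}$ and there is an ordering $\alpha_1,\dots,\alpha_n$ of the elements of $\alpha$ and an index $i$ with $\beta=\{\alpha_1+1,\dots,\alpha_{i-1}+1,\alpha_i+2,\alpha_{i+1}+1,\dots,\alpha_n+1\}$. -}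

module Defs where

open import Data.Nat using (ℕ; suc; _+_; _*_; _<_)
open import Data.Nat.DivMod using (_mod_)
open import Data.Fin using (Fin; toℕ)
open import Data.Fin.Subset using (Subset; _∈_; _∉_; ∣_∣)
open import Data.Product using (Σ; ∃; _×_)
open import Relation.Nullary using (¬_)
open import Relation.Binary.PropositionalEquality using (_≡_; _≢_)
open import Function.Bundles using (_⇔_)
open import Function.Definitions using (Injective)

-- The ground set [2n+2] is modelled as Fin (2n+2) = {0,…,2n+1}
-- (element k of [2n+2] corresponds to k-1; cyclic structure preserved).
N : ℕ → ℕ
N n = 2 + 2 * n

addMod : ∀ n → Fin (N n) → ℕ → Fin (N n)
addMod n x k = (toℕ x + k) mod (N n)

Stable : ∀ n → Subset (N n) → Set
Stable n s = ∀ (x : Fin (N n)) → ¬ (x ∈ s × addMod n x 1 ∈ s)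

Vertex : ∀ n → Subset (N n) → Set
Vertex n s = ∣ s ∣ ≡ n × Stable n s

Disjoint : ∀ {m} → Subset m → Subset m → Set
Disjoint {m} s t = ∀ (x : Fin m) → ¬ (x ∈ s × x ∈ t)

Adjacent : ∀ n → Subset (N n) → Subset (N n) → Set
Adjacent n α β = Vertex n α × Vertex n β × Disjoint α β

Tight : ∀ n → Subset (N n) → Set
Tight n α = Vertex n α ×
  Σ (Fin (N n)) λ i → ∀ (x : Fin (N n)) →
    (x ∈ α) ⇔ (∃ λ (k : ℕ) → k < n × x ≡ addMod n i (2 * k))

Ordering : ∀ n → Subset (N n) → (Fin n → Fin (N n)) → Set
Ordering n α e = Injective _≡_ _≡_ e × (∀ x → (x ∈ α) ⇔ (∃ λ j → x ≡ e j))

shiftAt : ∀ n → (Fin n → Fin (N n)) → Fin n → Fin n → Fin (N n)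
shiftAt n e i j with Data.Fin._≟_ i j
... | Relation.Nullary.yes _ = addMod n (e j) 2
... | Relation.Nullary.no _ = addMod n (e j) 1

OuterNeighbor : ∀ n → Subset (N n) → Subset (N n) → Set
OuterNeighbor n α β = Adjacent n α β ×
  Σ (Fin n → Fin (N n)) λ e → Ordering n α e ×
  Σ (Fin n) λ i → ∀ (x : Fin (N n)) → (x ∈ β) ⇔ (∃ λ j → x ≡ shiftAt n e i j)

module Submission where

-- Write n = m + 1 and let α = {i, i+2, …, i+2m} be the tight set, naming the
-- points of [2n+2] by their offset from i: A k = i + k.  If β is an outer
-- neighbour of α, obtained from an ordering e of α by shifting e j by 2 and all
-- other elements by 1, then e j must be the last point A(2m): for any other
-- point A(2k) of α the point A(2k) + 2 = A(2k+2) lies in α, so it cannot lie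
-- in the disjoint set β.  All other elements of α move to odd offsets, hence
--   β = {A 1, A 3, …, A(2m-1)} ∪ {A(2n)}
-- whatever the ordering was, which gives uniqueness.  Conversely, ordering α by
-- increasing offset and shifting the last element by 2 produces this very set,
-- which has n elements, is stable and is disjoint from α.

open import Defs
open import Data.Nat using (ℕ; _≥_; zero; suc; _+_; _*_; _∸_; _<_; _≤_; s≤s; NonZero)
open import Data.Nat.Properties
open import Data.Nat.DivMod
open import Data.Fin as F using (Fin; toℕ; fromℕ; fromℕ<)
open import Data.Fin.Properties using (toℕ-fromℕ<; toℕ-injective; toℕ-fromℕ; toℕ<n)
  renaming (suc-injective to Fin-suc-injective)
open import Data.Fin.Subset using (Subset; _∈_; _∉_; ⁅_⁆; _∪_; ⊥; ∣_∣; inside; outside)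
open import Data.Fin.Subset.Properties using (∉⊥; x∈p∪q⁻; x∈p∪q⁺; x∈⁅y⁆⇒x≡y; x∈⁅x⁆; ∪-identityˡ; ∣⊥∣≡0; ⊆-antisym)
open import Data.Vec using (_∷_; here; there)
open import Data.Product using (Σ; ∃-syntax; _×_; _,_; proj₁; proj₂)
open import Data.Sum using (_⊎_; inj₁; inj₂)
open import Data.Empty using (⊥-elim)
open import Relation.Nullary using (¬_; Dec; yes; no)
open import Relation.Binary.PropositionalEquality
open import Function using (_∘_)
open import Function.Bundles using (_⇔_; mk⇔; Equivalence)
open import Function.Construct.Composition using (_⇔-∘_)
open import Function.Construct.Symmetry using (⇔-sym)
open import Function.Definitions using (Injective)
open import Algebra.Properties.CommutativeSemigroup +-commutativeSemigroup using (xy∙z≈xz∙y)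

open Equivalence using (to; from)

image : ∀ {m k} → (Fin k → Fin m) → Subset m
image {k = zero}  f = ⊥
image {k = suc k} f = ⁅ f F.zero ⁆ ∪ image (f ∘ F.suc)

image⁻ : ∀ {m k} (f : Fin k → Fin m) x → x ∈ image f → ∃[ j ] x ≡ f j
image⁻ {k = zero}  f x p = ⊥-elim (∉⊥ p)
image⁻ {k = suc k} f x p with x∈p∪q⁻ ⁅ f F.zero ⁆ (image (f ∘ F.suc)) p
... | inj₁ x∈head = F.zero , x∈⁅y⁆⇒x≡y _ x∈head
... | inj₂ x∈tail with image⁻ (f ∘ F.suc) x x∈tail
...   | j , x≡fj = F.suc j , x≡fj

image⁺ : ∀ {m k} (f : Fin k → Fin m) x → ∃[ j ] x ≡ f j → x ∈ image f
image⁺ {k = suc k} f x (F.zero , refl) =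
  x∈p∪q⁺ {p = ⁅ f F.zero ⁆} {q = image (f ∘ F.suc)} (inj₁ (x∈⁅x⁆ _))
image⁺ {k = suc k} f x (F.suc j , x≡fj) =
  x∈p∪q⁺ {p = ⁅ f F.zero ⁆} {q = image (f ∘ F.suc)} (inj₂ (image⁺ (f ∘ F.suc) x (j , x≡fj)))

∈-image⇔ : ∀ {m k} (f : Fin k → Fin m) x → x ∈ image f ⇔ (∃[ j ] x ≡ f j)
∈-image⇔ f x = mk⇔ (image⁻ f x) (image⁺ f x)

∣⁅x⁆∪p∣≡1+∣p∣ : ∀ {m} (x : Fin m) (p : Subset m) → x ∉ p → ∣ ⁅ x ⁆ ∪ p ∣ ≡ suc ∣ p ∣
∣⁅x⁆∪p∣≡1+∣p∣ F.zero    (inside  ∷ p) x∉p = ⊥-elim (x∉p here)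
∣⁅x⁆∪p∣≡1+∣p∣ F.zero    (outside ∷ p) x∉p = cong (suc ∘ ∣_∣) (∪-identityˡ p)
∣⁅x⁆∪p∣≡1+∣p∣ (F.suc x) (inside  ∷ p) x∉p = cong suc (∣⁅x⁆∪p∣≡1+∣p∣ x p (x∉p ∘ there))
∣⁅x⁆∪p∣≡1+∣p∣ (F.suc x) (outside ∷ p) x∉p = ∣⁅x⁆∪p∣≡1+∣p∣ x p (x∉p ∘ there)

∣image∣ : ∀ {m k} (f : Fin k → Fin m) → Injective _≡_ _≡_ f → ∣ image f ∣ ≡ k
∣image∣ {m} {k = zero}  f f-inj = ∣⊥∣≡0 m
∣image∣ {k = suc k} f f-inj =
  trans (∣⁅x⁆∪p∣≡1+∣p∣ (f F.zero) _ head∉tail)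
        (cong suc (∣image∣ (f ∘ F.suc) (Fin-suc-injective ∘ f-inj)))
  where
  head∉tail : f F.zero ∉ image (f ∘ F.suc)
  head∉tail p with image⁻ (f ∘ F.suc) (f F.zero) p
  ... | j , eq with f-inj {F.zero} {F.suc j} eq
  ...   | ()

⇔-ext : ∀ {m} {p q : Subset m} → (∀ x → x ∈ p ⇔ x ∈ q) → p ≡ q
⇔-ext p⇔q = ⊆-antisym (λ {x} → to (p⇔q x)) (λ {x} → from (p⇔q x))

%-absorbˡ : ∀ m n d .{{_ : NonZero d}} → (m % d + n) % d ≡ (m + n) % d
%-absorbˡ m n d = begin
  (m % d + n) % d         ≡⟨ %-distribˡ-+ (m % d) n d ⟩
  (m % d % d + n % d) % d ≡⟨ cong (λ r → (r + n % d) % d) (m%n%n≡m%n m d) ⟩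
  (m % d + n % d) % d     ≡⟨ %-distribˡ-+ m n d ⟨
  (m + n) % d             ∎
  where open ≡-Reasoning

complement-cancels : ∀ t M .{{_ : NonZero M}} → (t + (M ∸ t % M)) % M ≡ 0
complement-cancels t M = begin
  (t + (M ∸ r)) % M         ≡⟨ cong (λ s → (s + (M ∸ r)) % M) (m≡m%n+[m/n]*n t M) ⟩
  (r + q * M + (M ∸ r)) % M ≡⟨ cong (_% M) (xy∙z≈xz∙y r (q * M) (M ∸ r)) ⟩
  (r + (M ∸ r) + q * M) % M ≡⟨ [m+kn]%n≡m%n (r + (M ∸ r)) q M ⟩
  (r + (M ∸ r)) % M         ≡⟨ cong (_% M) (m+[n∸m]≡n (m%n≤n t M)) ⟩
  M % M                     ≡⟨ n%n≡0 M ⟩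
  0                         ∎
  where
  open ≡-Reasoning
  r = t % M
  q = t / M

untranslate : ∀ t a M .{{_ : NonZero M}} → a < M → ((t + a) % M + (M ∸ t % M)) % M ≡ a
untranslate t a M a<M = begin
  ((t + a) % M + c) % M     ≡⟨ %-absorbˡ (t + a) c M ⟩
  (t + a + c) % M           ≡⟨ cong (_% M) (xy∙z≈xz∙y t a c) ⟩
  (t + c + a) % M           ≡⟨ %-distribˡ-+ (t + c) a M ⟩
  ((t + c) % M + a % M) % M ≡⟨ cong (λ s → (s + a % M) % M) (complement-cancels t M) ⟩
  a % M % M                 ≡⟨ m%n%n≡m%n a M ⟩
  a % M                     ≡⟨ m<n⇒m%n≡m a<M ⟩
  a                         ∎
  where
  open ≡-Reasoning
  c = M ∸ t % M

translate-injective : ∀ t {a b} M .{{_ : NonZero M}} → a < M → b < M →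
                      (t + a) % M ≡ (t + b) % M → a ≡ b
translate-injective t {a} {b} M a<M b<M eq = begin
  a                     ≡⟨ untranslate t a M a<M ⟨
  ((t + a) % M + c) % M ≡⟨ cong (λ s → (s + c) % M) eq ⟩
  ((t + b) % M + c) % M ≡⟨ untranslate t b M b<M ⟩
  b                     ∎
  where
  open ≡-Reasoning
  c = M ∸ t % M

toℕ-addMod : ∀ n (x : Fin (N n)) k → toℕ (addMod n x k) ≡ (toℕ x + k) % N n
toℕ-addMod n x k = toℕ-fromℕ< _

addMod-+ : ∀ n (x : Fin (N n)) a b → addMod n (addMod n x a) b ≡ addMod n x (a + b)
addMod-+ n x a b = toℕ-injective (begin
  toℕ (addMod n (addMod n x a) b) ≡⟨ toℕ-addMod n (addMod n x a) b ⟩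
  (toℕ (addMod n x a) + b) % N n  ≡⟨ cong (λ s → (s + b) % N n) (toℕ-addMod n x a) ⟩
  ((toℕ x + a) % N n + b) % N n   ≡⟨ %-absorbˡ (toℕ x + a) b (N n) ⟩
  (toℕ x + a + b) % N n           ≡⟨ cong (_% N n) (+-assoc (toℕ x) a b) ⟩
  (toℕ x + (a + b)) % N n         ≡⟨ toℕ-addMod n x (a + b) ⟨
  toℕ (addMod n x (a + b))        ∎)
  where open ≡-Reasoning

addMod-injective : ∀ n (x : Fin (N n)) {a b} → a < N n → b < N n →
                   addMod n x a ≡ addMod n x b → a ≡ b
addMod-injective n x a<N b<N eq = translate-injective (toℕ x) (N n) a<N b<N
  (trans (sym (toℕ-addMod n x _)) (trans (cong toℕ eq) (toℕ-addMod n x _)))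

shiftAt-here : ∀ n e (i j : Fin n) → i ≡ j → shiftAt n e i j ≡ addMod n (e j) 2
shiftAt-here n e i j i≡j with i F.≟ j
... | yes _   = refl
... | no i≢j  = ⊥-elim (i≢j i≡j)

shiftAt-there : ∀ n e (i j : Fin n) → i ≢ j → shiftAt n e i j ≡ addMod n (e j) 1
shiftAt-there n e i j i≢j with i F.≟ j
... | yes i≡j = ⊥-elim (i≢j i≡j)
... | no _    = refl

module TightSet (m : ℕ) (α : Subset (N (suc m))) (i : Fin (N (suc m)))
  (tight : ∀ x → (x ∈ α) ⇔ (∃[ k ] k < suc m × x ≡ addMod (suc m) i (2 * k))) where

  n : ℕ
  n = suc m

  A : ℕ → Fin (N n)
  A = addMod n i

  A-step : ∀ a k → addMod n (A a) k ≡ A (k + a)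
  A-step a k = trans (addMod-+ n i a k) (cong A (+-comm a k))

  A-injective : ∀ {a b} → a ≤ suc (2 * n) → b ≤ suc (2 * n) → A a ≡ A b → a ≡ b
  A-injective a≤ b≤ = addMod-injective n i (s≤s a≤) (s≤s b≤)

  even-injective : ∀ {j k} → j ≤ n → k ≤ n → A (2 * j) ≡ A (2 * k) → j ≡ k
  even-injective {j} {k} j≤n k≤n eq =
    *-cancelˡ-≡ j k 2 (A-injective (even≤ j≤n) (even≤ k≤n) eq)
    where
    even≤ : ∀ {l} → l ≤ n → 2 * l ≤ suc (2 * n)
    even≤ l≤n = m≤n⇒m≤1+n (*-monoʳ-≤ 2 l≤n)

  odd-injective : ∀ {j k} → j ≤ n → k ≤ n → A (suc (2 * j)) ≡ A (suc (2 * k)) → j ≡ k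
  odd-injective {j} {k} j≤n k≤n eq =
    *-cancelˡ-≡ j k 2 (suc-injective (A-injective (odd≤ j≤n) (odd≤ k≤n) eq))
    where
    odd≤ : ∀ {l} → l ≤ n → suc (2 * l) ≤ suc (2 * n)
    odd≤ l≤n = s≤s (*-monoʳ-≤ 2 l≤n)

  even≢odd-point : ∀ {j k} → j ≤ n → k ≤ n → A (2 * j) ≢ A (suc (2 * k))
  even≢odd-point {j} {k} j≤n k≤n eq = even≢odd j k
    (A-injective (m≤n⇒m≤1+n (*-monoʳ-≤ 2 j≤n)) (s≤s (*-monoʳ-≤ 2 k≤n)) eq)

  double-step : ∀ k → addMod n (A (2 * k)) 2 ≡ A (2 * suc k)
  double-step k = trans (A-step (2 * k) 2) (cong A (sym (*-suc 2 k)))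

  below-n : ∀ {k} → k < m → k ≤ n
  below-n k<m = m<n⇒m≤1+n k<m

  α-point : ∀ {k} → k < n → A (2 * k) ∈ α
  α-point {k} k<n = from (tight (A (2 * k))) (k , k<n , refl)

  α-offset : ∀ {x} → x ∈ α → ∃[ k ] k < n × x ≡ A (2 * k)
  α-offset {x} = to (tight x)

  last-point : ∀ {x} → x ∈ α → addMod n x 2 ∉ α → x ≡ A (2 * m)
  last-point x∈α x+2∉α with α-offset x∈α
  ... | k , k<n , refl with k ≟ m
  ...   | yes refl = refl
  ...   | no  k≢m  = ⊥-elim (x+2∉α (subst (_∈ α) (sym (double-step k)) (α-point (s≤s k<m))))
    where
    k<m : k < m
    k<m = ≤∧≢⇒< (≤-pred k<n) k≢m

  OuterPoint : Fin (N n) → Set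
  OuterPoint x = x ≡ A (2 * n) ⊎ (∃[ k ] k < m × x ≡ A (suc (2 * k)))

  outer-disjoint : ∀ {x} → x ∈ α → ¬ OuterPoint x
  outer-disjoint x∈α outer with α-offset x∈α
  outer-disjoint x∈α (inj₁ refl) | k , k<n , eq =
    <⇒≢ k<n (even-injective (<⇒≤ k<n) ≤-refl (sym eq))
  outer-disjoint x∈α (inj₂ (k′ , k′<m , refl)) | k , k<n , eq =
    even≢odd-point (<⇒≤ k<n) (below-n k′<m) (sym eq)

  outer-stable : ∀ {x} → OuterPoint x → ¬ OuterPoint (addMod n x 1)
  outer-stable (inj₁ refl) next rewrite A-step (2 * n) 1 with next
  ... | inj₁ eq               = even≢odd-point ≤-refl ≤-refl (sym eq)
  ... | inj₂ (k′ , k′<m , eq) = <⇒≢ (m<n⇒m<1+n k′<m) (sym (odd-injective ≤-refl (below-n k′<m) eq))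
  outer-stable (inj₂ (k , k<m , refl)) next
    rewrite A-step (suc (2 * k)) 1 | sym (*-suc 2 k) with next
  ... | inj₁ eq               = <⇒≢ k<m (suc-injective (even-injective (m<n⇒m<1+n k<m) ≤-refl eq))
  ... | inj₂ (k′ , k′<m , eq) = even≢odd-point (m<n⇒m<1+n k<m) (below-n k′<m) eq

  module _ {e : Fin n → Fin (N n)} (ordered : Ordering n α e)
           (j : Fin n) (e-last : e j ≡ A (2 * m)) where

    private
      e-injective : Injective _≡_ _≡_ e
      e-injective = proj₁ ordered
      listed : ∀ x → x ∈ α ⇔ (∃[ j′ ] x ≡ e j′)
      listed = proj₂ ordered

    shift-last : shiftAt n e j j ≡ A (2 * n)
    shift-last = trans (shiftAt-here n e j j refl)
                       (trans (cong (λ y → addMod n y 2) e-last) (double-step m))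

    shift-other : ∀ {j′ k} → j ≢ j′ → e j′ ≡ A (2 * k) → shiftAt n e j j′ ≡ A (suc (2 * k))
    shift-other {j′} {k} j≢j′ e-j′ = trans (shiftAt-there n e j j′ j≢j′)
                                          (trans (cong (λ y → addMod n y 1) e-j′) (A-step (2 * k) 1))

    others-below-last : ∀ {j′} → j ≢ j′ → ∃[ k ] k < m × e j′ ≡ A (2 * k)
    others-below-last {j′} j≢j′ with α-offset (from (listed (e j′)) (j′ , refl))
    ... | k , k<n , e-j′ with k ≟ m
    ...   | yes refl = ⊥-elim (j≢j′ (e-injective (trans e-last (sym e-j′))))
    ...   | no k≢m   = k , ≤∧≢⇒< (≤-pred k<n) k≢m , e-j′

    shifted⇒outer : ∀ x → (∃[ j′ ] x ≡ shiftAt n e j j′) → OuterPoint x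
    shifted⇒outer x (j′ , x≡) = classify (j F.≟ j′)
      where
      classify : Dec (j ≡ j′) → OuterPoint x
      classify (yes refl) = inj₁ (trans x≡ shift-last)
      classify (no j≢j′)  = let k , k<m , e-j′ = others-below-last j≢j′
                            in  inj₂ (k , k<m , trans x≡ (shift-other {k = k} j≢j′ e-j′))

    outer⇒shifted : ∀ x → OuterPoint x → ∃[ j′ ] x ≡ shiftAt n e j j′
    outer⇒shifted x (inj₁ refl) = j , sym shift-last
    outer⇒shifted x (inj₂ (k , k<m , refl)) with to (listed (A (2 * k))) (α-point (m<n⇒m<1+n k<m))
    ... | j′ , A2k≡ej′ = j′ , sym (shift-other {k = k} j≢j′ (sym A2k≡ej′))
      where
      j≢j′ : j ≢ j′
      j≢j′ refl = <⇒≢ k<m (even-injective (below-n k<m) (n≤1+n m) (trans A2k≡ej′ e-last))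

    shifted⇔outer : ∀ x → (∃[ j′ ] x ≡ shiftAt n e j j′) ⇔ OuterPoint x
    shifted⇔outer x = mk⇔ (shifted⇒outer x) (outer⇒shifted x)

  -- Every outer neighbour of α consists exactly of the outer points: its doubly
  -- shifted element must be A(2m), since its shift by 2 lies outside α.
  outer-members : ∀ {γ} → OuterNeighbor n α γ → ∀ x → x ∈ γ ⇔ OuterPoint x
  outer-members {γ} ((_ , _ , α∩γ=∅) , e , ordered , j , γ-listed) x =
    shifted⇔outer ordered j e-last x ⇔-∘ γ-listed x
    where
    ej∈α : e j ∈ α
    ej∈α = from (proj₂ ordered (e j)) (j , refl)
    ej+2∈γ : addMod n (e j) 2 ∈ γ
    ej+2∈γ = from (γ-listed _) (j , sym (shiftAt-here n e j j refl))
    e-last : e j ≡ A (2 * m)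
    e-last = last-point ej∈α (λ ej+2∈α → α∩γ=∅ _ (ej+2∈α , ej+2∈γ))

  canonical : Fin n → Fin (N n)
  canonical j = A (2 * toℕ j)

  canonical-ordered : Ordering n α canonical
  canonical-ordered = injective , λ x → mk⇔ (listed x) (unlisted x)
    where
    injective : Injective _≡_ _≡_ canonical
    injective {a} {b} eq = toℕ-injective (even-injective (<⇒≤ (toℕ<n a)) (<⇒≤ (toℕ<n b)) eq)
    listed : ∀ x → x ∈ α → ∃[ j ] x ≡ canonical j
    listed x x∈α with α-offset x∈α
    ... | k , k<n , refl = fromℕ< k<n , cong (λ l → A (2 * l)) (sym (toℕ-fromℕ< k<n))
    unlisted : ∀ x → (∃[ j ] x ≡ canonical j) → x ∈ α
    unlisted x (j , refl) = α-point (toℕ<n j)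

  last : Fin n
  last = fromℕ m

  canonical-last : canonical last ≡ A (2 * m)
  canonical-last = cong (λ l → A (2 * l)) (toℕ-fromℕ m)

  canonicalShift : Fin n → Fin (N n)
  canonicalShift = shiftAt n canonical last

  canonicalShift-other : ∀ c → last ≢ c → canonicalShift c ≡ A (suc (2 * toℕ c))
  canonicalShift-other c last≢c = shift-other canonical-ordered last canonical-last {k = toℕ c} last≢c refl

  -- The last point goes to an even offset, all others to distinct odd offsets.
  last≢other : ∀ c → last ≢ c → canonicalShift last ≢ canonicalShift c
  last≢other c last≢c eq = even≢odd-point ≤-refl (<⇒≤ (toℕ<n c))
    (trans (sym (shift-last canonical-ordered last canonical-last))
           (trans eq (canonicalShift-other c last≢c)))

  canonicalShift-injective : Injective _≡_ _≡_ canonicalShift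
  canonicalShift-injective {a} {b} eq = compare (last F.≟ a) (last F.≟ b)
    where
    compare : Dec (last ≡ a) → Dec (last ≡ b) → a ≡ b
    compare (yes refl)  (yes refl)  = refl
    compare (yes refl)  (no last≢b) = ⊥-elim (last≢other b last≢b eq)
    compare (no last≢a) (yes refl)  = ⊥-elim (last≢other a last≢a (sym eq))
    compare (no last≢a) (no last≢b) = toℕ-injective (odd-injective (<⇒≤ (toℕ<n a)) (<⇒≤ (toℕ<n b))
      (trans (sym (canonicalShift-other a last≢a)) (trans eq (canonicalShift-other b last≢b))))

  β : Subset (N n)
  β = image canonicalShift

  β-members : ∀ x → x ∈ β ⇔ OuterPoint x
  β-members x = shifted⇔outer canonical-ordered last canonical-last x ⇔-∘ ∈-image⇔ canonicalShift x

  β-outer : Vertex n α → OuterNeighbor n α β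
  β-outer α-vertex =
    (α-vertex , β-vertex , β-disjoint) , canonical , canonical-ordered , last , ∈-image⇔ canonicalShift
    where
    β-vertex : Vertex n β
    β-vertex = ∣image∣ canonicalShift canonicalShift-injective ,
               λ x x,x+1∈β → outer-stable (to (β-members x) (proj₁ x,x+1∈β))
                                          (to (β-members _) (proj₂ x,x+1∈β))
    β-disjoint : Disjoint α β
    β-disjoint x (x∈α , x∈β) = outer-disjoint x∈α (to (β-members x) x∈β)

mainTheorem3 : ∀ (n : ℕ) → n ≥ 1 → (α : Subset (N n)) → Tight n α →
    Σ (Subset (N n)) λ β → OuterNeighbor n α β ×
      (∀ (γ : Subset (N n)) → OuterNeighbor n α γ → γ ≡ β)
mainTheorem3 (suc m) _ α (α-vertex , i , tight) = β , β-outer α-vertex , unique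
  where
  open TightSet m α i tight
  unique : ∀ γ → OuterNeighbor (suc m) α γ → γ ≡ β
  unique γ γ-outer = ⇔-ext (λ x → ⇔-sym (β-members x) ⇔-∘ outer-members γ-outer x)
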